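{- For each $N\in\{0,1,2,4,8,10,12,19,24,34,36,38,42,46,72,76,108,127,138,200\}$, the elementary cellular automaton $F_N$ satisfies $D(\textsc{Pred}_{F_N,n})\in O(1)$.
   Context: The ECA with Wolfram number $N$ is $F_N:\{0,1\}^{\mathbb{Z}}\to\{0,1\}^{\mathbb{Z}}$, $(F_N(x))_i=f_N(x_{i-1},x_i,x_{i+1})$, where $f_N(a,b,c)$ is the bit of index $4a+2b+c$ of $N$ in binary. On a finite word of length $m$, $F_N$ returns the word of length $m-2$ obtained by applying $f_N$ wherever it is defined. $\textsc{Pred}_{F,n}:\{0,1\}^{2n+1}\to\{0,1\}$ maps $x$ to the unique cell of $F^n(x)$. For finite sets $X,Y,Z$ and $g:X\times Y\to Z$, $D(g)$ is the minimal depth of a deterministic two-party communication protocol tree computing $g$ (Alice knows $x$, Bob knows $y$; internal nodes are labelled by a function of $x$ alone or of $y$ alone to $\{\mathrm{l},\mathrm{r}\}$ selecting the child, leaves are labelled by outputs). For $g:\{0,1\}^m\to Z$, $D(g)=\max_{0\le i\le m} D(g_i)$ where $g_i:\{0,1\}^i\times\{0,1\}^{m-i}\to Z$, $g_i(x,y)=g(xy)$. -}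

module Defs where

open import Data.Bool using (Bool; true; false; if_then_else_)
open import Data.Nat using (ℕ; zero; suc; _+_; _*_; _%_; _/_; _≡ᵇ_; _≤_)
open import Data.Vec using (Vec; []; _∷_; _++_)
open import Data.Product using (Σ; ∃; _×_)
open import Relation.Binary.PropositionalEquality using (_≡_; subst)

bit : ℕ → ℕ → Bool
bit N zero    = (N % 2) ≡ᵇ 1
bit N (suc k) = bit (N / 2) k

b2n : Bool → ℕ
b2n true  = 1
b2n false = 0

rule : ℕ → Bool → Bool → Bool → Bool
rule N a b c = bit N (4 * b2n a + 2 * b2n b + b2n c)

step : ℕ → ∀ {m} → Vec Bool (suc (suc m)) → Vec Bool m
step N {zero}  (a ∷ b ∷ [])       = []
step N {suc m} (a ∷ b ∷ c ∷ rest) = rule N a b c ∷ step N (b ∷ c ∷ rest)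

len : ℕ → ℕ
len zero    = 1
len (suc n) = suc (suc (len n))

iter : ℕ → (n : ℕ) → Vec Bool (len n) → Vec Bool 1
iter N zero    x = x
iter N (suc n) x = iter N n (step N x)

Pred : ℕ → (n : ℕ) → Vec Bool (len n) → Bool
Pred N n x with iter N n x
... | b ∷ [] = b

data Protocol (X Y Z : Set) : Set where
  leaf  : Z → Protocol X Y Z
  alice : (X → Bool) → Protocol X Y Z → Protocol X Y Z → Protocol X Y Z
  bob   : (Y → Bool) → Protocol X Y Z → Protocol X Y Z → Protocol X Y Z

run : ∀ {X Y Z} → Protocol X Y Z → X → Y → Z
run (leaf z)      x y = z
run (alice f l r) x y = if f x then run l x y else run r x y
run (bob g l r)   x y = if g y then run l x y else run r x y

depth : ∀ {X Y Z} → Protocol X Y Z → ℕ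
depth (leaf _)      = 0
depth (alice _ l r) = suc (depth l Data.Nat.⊔ depth r)
depth (bob _ l r)   = suc (depth l Data.Nat.⊔ depth r)

-- D(g) ≤ c for g : X × Y → Z  (D is a minimum over protocols)
D≤ : ∀ {X Y Z : Set} → (X → Y → Z) → ℕ → Set
D≤ {X} {Y} {Z} g c =
  Σ (Protocol X Y Z) λ P → (depth P ≤ c) × (∀ x y → run P x y ≡ g x y)

-- D(g) ≤ c for g : {0,1}^m → Z : every cut g_i (i + j = m) has D(g_i) ≤ c
Dword≤ : ∀ {m} {Z : Set} → (Vec Bool m → Z) → ℕ → Set
Dword≤ {m} g c =
  (i j : ℕ) (e : i + j ≡ m) →
  D≤ (λ (x : Vec Bool i) (y : Vec Bool j) → g (subst (Vec Bool) e (x ++ y))) c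

-- For each listed rule the prediction is eventually shift-periodic in time: there are k, p > 0, d
-- such that predicting k + p steps ahead equals predicting k steps ahead on the input shifted by d.
-- The identity only involves the first 2(k + p) + 1 cells, so it is checked exhaustively, and it
-- propagates to every time m ≥ k. Hence Pred_{F_N,n} depends on at most 2(k + p) + 1 input cells
-- whatever n is, and querying those cells one by one, each by the party that holds it, is a
-- protocol of constant depth for every cut of the input.
module Submission where

open import Defs
open import Data.Nat using (ℕ)
open import Data.List using (List; _∷_; [])
open import Data.List.Membership.Propositional using (_∈_)
open import Data.Product using (∃)

open import Data.Bool using (Bool; true; false; if_then_else_; _∧_; T)
open import Data.Bool.Properties using (T-∧)
import Data.Bool as Bool
open import Data.Empty using (⊥-elim)
open import Data.List using (length; map; upTo)
open import Data.List.Properties using (length-map; length-upTo)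
open import Data.List.Membership.Propositional.Properties using (∈-map⁺; ∈-upTo⁺)
open import Data.List.Relation.Unary.All using (All; []; _∷_) renaming (lookup to lookupAll)
open import Data.List.Relation.Unary.Any using (here; there)
open import Data.Nat using (zero; suc; _+_; _∸_; _≤_; _<_; _≤′_; ≤′-refl; ≤′-step; _≤ᵇ_; _⊔_; _<?_; z≤n; s≤s; NonZero; >-nonZero⁻¹)
open import Data.Nat.Induction using (<-rec)
open import Data.Nat.Properties
  using (_≟_; ≤-reflexive; ≤-trans; <⇒≤; ≮⇒≥; ≤ᵇ⇒≤; ≤⇒≤′; m≤n+m; m∸n+n≡m; m+n≤o⇒m≤o∸n; +-monoˡ-<; ∸-monoʳ-<; m<n⇒m<1+n; ⊔-lub)
open import Data.Product using (_×_; _,_; proj₁; proj₂)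
open import Data.Sum using (_⊎_; inj₁; inj₂; [_,_]′)
import Data.Sum as Sum
open import Data.Vec using (Vec; []; _∷_; _++_)
open import Function using (_∘_; Equivalence)
open import Relation.Binary.PropositionalEquality using (_≡_; refl; sym; trans; cong₂; subst; module ≡-Reasoning)
open import Relation.Nullary using (yes; no; ⌊_⌋)
open import Relation.Nullary.Decidable using (toWitness)

Config : Set
Config = ℕ → Bool

cell : ∀ {m} → Vec Bool m → Config
cell []      _       = false
cell (a ∷ w) zero    = a
cell (a ∷ w) (suc i) = cell w i

_∷ᶜ_ : Bool → Config → Config
(b ∷ᶜ u) zero    = b
(b ∷ᶜ u) (suc x) = u x

shift : ℕ → Config → Config
shift d u x = u (x + d)

_[_]≔_ : Config → ℕ → Bool → Config
(u [ p ]≔ b) x with x ≟ p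
... | yes _ = b
... | no  _ = u x

-- Cell 0 of F_N^t applied to u, unfolded at the last step rather than the first (cf. predict-evolve).
predict : ℕ → ℕ → Config → Bool
predict N zero    u = u 0
predict N (suc t) u = rule N (predict N t u) (predict N t (u ∘ suc)) (predict N t (u ∘ suc ∘ suc))

evolve : ℕ → Config → Config
evolve N u x = rule N (u x) (u (suc x)) (u (suc (suc x)))

predict-evolve : ∀ N t u → predict N t (evolve N u) ≡ predict N (suc t) u
predict-evolve N zero    u = refl
predict-evolve N (suc t) u
  rewrite predict-evolve N t u | predict-evolve N t (u ∘ suc) | predict-evolve N t (u ∘ suc ∘ suc) = refl

LocalTo : ∀ {Z : Set} → ℕ → (Config → Z) → Set
LocalTo M G = ∀ u v → (∀ x → x < M → u x ≡ v x) → G u ≡ G v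

predict-local : ∀ N t → LocalTo (len t) (predict N t)
predict-local N zero    u v u≈v = u≈v 0 (s≤s z≤n)
predict-local N (suc t) u v u≈v
  rewrite predict-local N t u v (λ x x<M → u≈v x (m<n⇒m<1+n (m<n⇒m<1+n x<M)))
        | predict-local N t (u ∘ suc) (v ∘ suc) (λ x x<M → u≈v (suc x) (s≤s (m<n⇒m<1+n x<M)))
        | predict-local N t (u ∘ suc ∘ suc) (v ∘ suc ∘ suc) (λ x x<M → u≈v (suc (suc x)) (s≤s (s≤s x<M))) = refl

cell-step : ∀ N {m} (w : Vec Bool (suc (suc m))) x → x < m → cell (step N w) x ≡ evolve N (cell w) x
cell-step N {suc m} (a ∷ b ∷ c ∷ w) zero    _         = refl
cell-step N {suc m} (a ∷ b ∷ c ∷ w) (suc x) (s≤s x<m) = cell-step N (b ∷ c ∷ w) x x<m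

Pred≡predict : ∀ N t (w : Vec Bool (len t)) → Pred N t w ≡ predict N t (cell w)
Pred≡predict N zero    (b ∷ []) = refl
Pred≡predict N (suc t) w = begin
  Pred N t (step N w)                ≡⟨ Pred≡predict N t (step N w) ⟩
  predict N t (cell (step N w))      ≡⟨ predict-local N t _ _ (cell-step N w) ⟩
  predict N t (evolve N (cell w))    ≡⟨ predict-evolve N t (cell w) ⟩
  predict N (suc t) (cell w)         ∎
  where open ≡-Reasoning

allPrefixes : ℕ → (Config → Bool) → Bool
allPrefixes zero    Q = Q (λ _ → false)
allPrefixes (suc M) Q = allPrefixes M (Q ∘ (true ∷ᶜ_)) ∧ allPrefixes M (Q ∘ (false ∷ᶜ_))

allPrefixes-sound : ∀ M Q → LocalTo M Q → T (allPrefixes M Q) → ∀ u → T (Q u)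
allPrefixes-sound zero    Q local ok u = subst T (local _ _ (λ _ ())) ok
allPrefixes-sound (suc M) Q local ok u = subst T (local _ _ head∷tail≈u) (sound-at (u 0))
  where
  head∷tail≈u : ∀ x → x < suc M → (u 0 ∷ᶜ (u ∘ suc)) x ≡ u x
  head∷tail≈u zero    _ = refl
  head∷tail≈u (suc x) _ = refl

  local-∷ : ∀ b → LocalTo M (Q ∘ (b ∷ᶜ_))
  local-∷ b v w v≈w = local _ _ λ { zero _ → refl ; (suc x) (s≤s x<M) → v≈w x x<M }

  sound-at : ∀ b → T (Q (b ∷ᶜ (u ∘ suc)))
  sound-at true  = allPrefixes-sound M _ (local-∷ true)  (proj₁ (Equivalence.to T-∧ ok)) (u ∘ suc)
  sound-at false = allPrefixes-sound M _ (local-∷ false) (proj₂ (Equivalence.to T-∧ ok)) (u ∘ suc)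

Periodic : ℕ → ℕ → ℕ → ℕ → Set
Periodic N t p d = ∀ u → predict N (t + p) u ≡ predict N t (shift d u)

periodic-suc : ∀ {N t p d} → Periodic N t p d → Periodic N (suc t) p d
periodic-suc periodic u rewrite periodic u | periodic (u ∘ suc) | periodic (u ∘ suc ∘ suc) = refl

periodic-≤′ : ∀ {N k m p d} → k ≤′ m → Periodic N k p d → Periodic N m p d
periodic-≤′ ≤′-refl periodic = periodic
periodic-≤′ {N} {p = p} {d} (≤′-step {m} k≤′m) periodic =
  periodic-suc {N} {m} {p} {d} (periodic-≤′ k≤′m periodic)

periodicityCheck : ℕ → ℕ → ℕ → ℕ → Bool
periodicityCheck N k p d =
  (len k + d ≤ᵇ len (k + p)) ∧
  allPrefixes (len (k + p)) (λ u → ⌊ predict N (k + p) u Bool.≟ predict N k (shift d u) ⌋)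

periodicityCheck-sound : ∀ N k p d → T (periodicityCheck N k p d) → Periodic N k p d
periodicityCheck-sound N k p d ok u = toWitness (allPrefixes-sound _ _ local exhaustive u)
  where
  window-fits : len k + d ≤ len (k + p)
  window-fits = ≤ᵇ⇒≤ _ _ (proj₁ (Equivalence.to T-∧ ok))

  exhaustive : T (allPrefixes (len (k + p)) (λ u → ⌊ predict N (k + p) u Bool.≟ predict N k (shift d u) ⌋))
  exhaustive = proj₂ (Equivalence.to T-∧ ok)

  local : LocalTo (len (k + p)) (λ u → ⌊ predict N (k + p) u Bool.≟ predict N k (shift d u) ⌋)
  local v w v≈w = cong₂ (λ a b → ⌊ a Bool.≟ b ⌋)
    (predict-local N (k + p) v w v≈w)
    (predict-local N k _ _ (λ x x<len → v≈w (x + d) (≤-trans (+-monoˡ-< d x<len) window-fits)))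

DependsOn : ∀ {Z : Set} → (Config → Z) → List ℕ → Set
DependsOn G L = ∀ u v → (∀ x → x ∈ L → u x ≡ v x) → G u ≡ G v

Junta : ∀ {Z : Set} → (Config → Z) → ℕ → Set
Junta G c = ∃ λ L → length L ≤ c × DependsOn G L

local⇒junta : ∀ {Z M} {G : Config → Z} → LocalTo M G → Junta G M
local⇒junta {M = M} local =
  upTo M , ≤-reflexive (length-upTo M) , λ u v u≈v → local u v (λ x x<M → u≈v x (∈-upTo⁺ x<M))

junta-mono : ∀ {Z c c′} {G : Config → Z} → c ≤ c′ → Junta G c → Junta G c′
junta-mono c≤c′ (L , L≤c , dep) = L , ≤-trans L≤c c≤c′ , dep

junta-shift : ∀ {Z c} {G H : Config → Z} d → (∀ u → G u ≡ H (shift d u)) → Junta H c → Junta G c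
junta-shift d G≡H∘shift (L , L≤c , dep) =
  map (_+ d) L , subst (_≤ _) (sym (length-map (_+ d) L)) L≤c ,
  λ u v u≈v → begin
    _ ≡⟨ G≡H∘shift u ⟩
    _ ≡⟨ dep (shift d u) (shift d v) (λ x x∈L → u≈v (x + d) (∈-map⁺ (_+ d) x∈L)) ⟩
    _ ≡⟨ sym (G≡H∘shift v) ⟩
    _ ∎
  where open ≡-Reasoning

len-mono : ∀ {m n} → m ≤ n → len m ≤ len n
len-mono {zero}  {zero}  _         = s≤s z≤n
len-mono {zero}  {suc n} _         = s≤s z≤n
len-mono {suc m} {suc n} (s≤s m≤n) = s≤s (s≤s (len-mono m≤n))

periodic⇒junta : ∀ {N k p d} .{{_ : NonZero p}} → (∀ {m} → k ≤ m → Periodic N m p d) →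
                 ∀ n → Junta (predict N n) (len (k + p))
periodic⇒junta {N} {k} {p} {d} periodic = <-rec _ junta
  where
  junta : ∀ n → (∀ {m} → m < n → Junta (predict N m) (len (k + p))) → Junta (predict N n) (len (k + p))
  junta n earlier with n <? k + p
  ... | yes n<k+p = junta-mono (len-mono (<⇒≤ n<k+p)) (local⇒junta (predict-local N n))
  ... | no  n≮k+p = junta-shift d one-period-back (earlier (∸-monoʳ-< (>-nonZero⁻¹ p) p≤n))
    where
    k+p≤n : k + p ≤ n
    k+p≤n = ≮⇒≥ n≮k+p

    p≤n : p ≤ n
    p≤n = ≤-trans (m≤n+m p k) k+p≤n

    one-period-back : ∀ u → predict N n u ≡ predict N (n ∸ p) (shift d u)
    one-period-back u = subst (λ t → predict N t u ≡ predict N (n ∸ p) (shift d u)) (m∸n+n≡m p≤n)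
                              (periodic (m+n≤o⇒m≤o∸n k k+p≤n) u)

locate : ℕ → ℕ → ℕ ⊎ ℕ
locate zero    p       = inj₂ p
locate (suc i) zero    = inj₁ zero
locate (suc i) (suc p) = Sum.map₁ suc (locate i p)

cell-++ : ∀ {i j} (x : Vec Bool i) (y : Vec Bool j) p → cell (x ++ y) p ≡ [ cell x , cell y ]′ (locate i p)
cell-++         []      y p       = refl
cell-++         (a ∷ x) y zero    = refl
cell-++ {suc i} (a ∷ x) y (suc p) with locate i p | cell-++ x y p
... | inj₁ q | x++y≡x = x++y≡x
... | inj₂ q | x++y≡y = x++y≡y

module _ {i j : ℕ} {Z : Set} where

  Tree : Set
  Tree = Protocol (Vec Bool i) (Vec Bool j) Z

  queryAt : ℕ ⊎ ℕ → Tree → Tree → Tree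
  queryAt (inj₁ q) l r = alice (λ x → cell x q) l r
  queryAt (inj₂ q) l r = bob   (λ y → cell y q) l r

  query : ℕ → Tree → Tree → Tree
  query p = queryAt (locate i p)

  run-query : ∀ p l r x y → run (query p l r) x y ≡ (if cell (x ++ y) p then run l x y else run r x y)
  run-query p l r x y rewrite cell-++ x y p with locate i p
  ... | inj₁ q = refl
  ... | inj₂ q = refl

  depth-query : ∀ p l r → depth (query p l r) ≡ suc (depth l ⊔ depth r)
  depth-query p l r with locate i p
  ... | inj₁ q = refl
  ... | inj₂ q = refl

  decisionTree : List ℕ → (Config → Z) → Tree
  decisionTree []      G = leaf (G (λ _ → false))
  decisionTree (p ∷ L) G =
    query p (decisionTree L (λ u → G (u [ p ]≔ true))) (decisionTree L (λ u → G (u [ p ]≔ false)))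

  depth-decisionTree : ∀ L G → depth (decisionTree L G) ≤ length L
  depth-decisionTree []      G = z≤n
  depth-decisionTree (p ∷ L) G = ≤-trans (≤-reflexive (depth-query p _ _))
    (s≤s (⊔-lub (depth-decisionTree L _) (depth-decisionTree L _)))

  ≔-self : ∀ u p x → (u [ p ]≔ u p) x ≡ u x
  ≔-self u p x with x ≟ p
  ... | yes refl = refl
  ... | no  _    = refl

  dependsOn-≔ : ∀ {p L} {G : Config → Z} → DependsOn G (p ∷ L) → ∀ b → DependsOn (λ u → G (u [ p ]≔ b)) L
  dependsOn-≔ {p} {L} dep b u v u≈v = dep _ _ agree
    where
    agree : ∀ x → x ∈ p ∷ L → (u [ p ]≔ b) x ≡ (v [ p ]≔ b) x
    agree x x∈ with x ≟ p | x∈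
    ... | yes _   | _          = refl
    ... | no  x≢p | here x≡p   = ⊥-elim (x≢p x≡p)
    ... | no  _   | there x∈L = u≈v x x∈L

  run-decisionTree : ∀ L G → DependsOn G L → ∀ x y → run (decisionTree L G) x y ≡ G (cell (x ++ y))
  run-decisionTree []      G dep x y = dep _ _ (λ _ ())
  run-decisionTree (p ∷ L) G dep x y = begin
    run (query p (tree true) (tree false)) x y                   ≡⟨ run-query p _ _ x y ⟩
    (if w p then run (tree true) x y else run (tree false) x y)  ≡⟨ branch (w p) ⟩
    run (tree (w p)) x y                                         ≡⟨ run-decisionTree L _ (dependsOn-≔ dep (w p)) x y ⟩
    G (w [ p ]≔ w p)                                             ≡⟨ dep _ _ (λ z _ → ≔-self w p z) ⟩
    G w                                                          ∎
    where
    open ≡-Reasoning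
    w : Config
    w = cell (x ++ y)

    tree : Bool → Tree
    tree b = decisionTree L (λ u → G (u [ p ]≔ b))

    branch : ∀ b → (if b then run (tree true) x y else run (tree false) x y) ≡ run (tree b) x y
    branch true  = refl
    branch false = refl

junta⇒Dword≤ : ∀ {m c} {Z : Set} (g : Vec Bool m → Z) (G : Config → Z) →
               (∀ w → g w ≡ G (cell w)) → Junta G c → Dword≤ g c
junta⇒Dword≤ g G g≡G (L , L≤c , dep) i j refl =
  decisionTree L G , ≤-trans (depth-decisionTree L G) L≤c ,
  λ x y → trans (run-decisionTree L G dep x y) (sym (g≡G (x ++ y)))

Pred-Dword-bounded : ∀ N k p d .{{_ : NonZero p}} → T (periodicityCheck N k p d) →
                     ∃ λ c → ∀ n → Dword≤ (Pred N n) c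
Pred-Dword-bounded N k p d ok =
  len (k + p) ,
  λ n → junta⇒Dword≤ (Pred N n) (predict N n) (Pred≡predict N n) (periodic⇒junta periodic n)
  where
  periodic : ∀ {m} → k ≤ m → Periodic N m p d
  periodic k≤m = periodic-≤′ (≤⇒≤′ k≤m) (periodicityCheck-sound N k p d ok)

listedRules : List ℕ
listedRules = 0 ∷ 1 ∷ 2 ∷ 4 ∷ 8 ∷ 10 ∷ 12 ∷ 19 ∷ 24 ∷ 34 ∷ 36 ∷ 38 ∷ 42 ∷ 46 ∷ 72 ∷ 76 ∷ 108 ∷ 127 ∷ 138 ∷ 200 ∷ []

listedRules-bounded : All (λ N → ∃ λ c → ∀ n → Dword≤ (Pred N n) c) listedRules
listedRules-bounded =
  Pred-Dword-bounded 0   1 1 0 _ ∷ Pred-Dword-bounded 1   1 2 2 _ ∷ Pred-Dword-bounded 2   1 1 2 _ ∷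
  Pred-Dword-bounded 4   1 1 1 _ ∷ Pred-Dword-bounded 8   2 1 0 _ ∷ Pred-Dword-bounded 10  1 1 2 _ ∷
  Pred-Dword-bounded 12  1 1 1 _ ∷ Pred-Dword-bounded 19  2 2 2 _ ∷ Pred-Dword-bounded 24  2 1 0 _ ∷
  Pred-Dword-bounded 34  1 1 2 _ ∷ Pred-Dword-bounded 36  2 1 1 _ ∷ Pred-Dword-bounded 38  2 2 4 _ ∷
  Pred-Dword-bounded 42  1 1 2 _ ∷ Pred-Dword-bounded 46  2 1 2 _ ∷ Pred-Dword-bounded 72  2 1 1 _ ∷
  Pred-Dword-bounded 76  1 1 1 _ ∷ Pred-Dword-bounded 108 2 2 2 _ ∷ Pred-Dword-bounded 127 1 2 2 _ ∷
  Pred-Dword-bounded 138 1 1 2 _ ∷ Pred-Dword-bounded 200 1 1 1 _ ∷ []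

proposition3 : (N : ℕ) →
    N ∈ (0 ∷ 1 ∷ 2 ∷ 4 ∷ 8 ∷ 10 ∷ 12 ∷ 19 ∷ 24 ∷ 34 ∷ 36 ∷ 38 ∷ 42 ∷ 46 ∷ 72 ∷ 76 ∷ 108 ∷ 127 ∷ 138 ∷ 200 ∷ []) →
    ∃ λ c → (n : ℕ) → Dword≤ (Pred N n) c
proposition3 N = lookupAll listedRules-bounded
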